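{- For all integers $n\ge1$ and $k\ge1$, $$\mathrm{spt}_{(1,1)}(n,k)=\left\lfloor\frac nk\right\rfloor\left\lfloor\frac{k\lfloor n/k\rfloor}{n}\right\rfloor+\sum_{m=1}^{\lfloor n/k\rfloor}m\sum_{\nu=1}^{k-1}(k-\nu)\,p(n-km,\nu).$$
   Context: $p(n,k)$ is the number of partitions of $n$ into exactly $k$ positive parts, with the conventions $p(0,1)=1$ and $p(n,k)=0$ if $n<0$, $k<1$, or $k>n$. For a partition $\lambda$, $\sigma(\lambda)$ is its smallest part and $\#(\lambda)$ the number of parts equal to $\sigma(\lambda)$. $\mathrm{spt}_{(a,b)}(n,k)=\sum_{\lambda}\sigma(\lambda)^a\#(\lambda)^b$ over all partitions $\lambda$ of $n$ into exactly $k$ parts. -}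

module Defs where

open import Data.Nat using (ℕ; zero; suc; _+_; _*_; _∸_; _≤?_; _≟_; _⊓_)
open import Data.List using (List; []; _∷_; map; concatMap; filter; applyUpTo; length; foldr)
open import Data.Nat.ListAction using (sum)
open import Relation.Nullary.Decidable using (⌊_⌋)
open import Data.Bool using (if_then_else_)

-- Partitions are represented as non-increasing lists of positive naturals.
-- partsBounded n k b : all partitions of n into exactly k parts, each part ≤ b,
-- listed as non-increasing lists (largest part first).
partsBounded : ℕ → ℕ → ℕ → List (List ℕ)
partsBounded n zero    b = if ⌊ n ≟ 0 ⌋ then ([] ∷ []) else []
partsBounded n (suc k) b =
  concatMap (λ a → map (a ∷_) (partsBounded (n ∸ a) k a))
            (filter (λ a → a ≤? n) (applyUpTo suc b))

partitions : ℕ → ℕ → List (List ℕ)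
partitions n k = partsBounded n k n

-- p(n,k) with the paper's conventions: p(0,1) = 1, and p(n,k) = 0 if k < 1 or k > n.
-- (Negative n never occurs in the statement since m ≤ ⌊n/k⌋.)
p : ℕ → ℕ → ℕ
p zero (suc zero) = 1
p zero _          = 0
p (suc n) k       = length (partitions (suc n) k)

-- σ(λ): smallest part (only used on non-empty partitions).
σ : List ℕ → ℕ
σ []       = 0
σ (x ∷ xs) = foldr _⊓_ x xs

#parts : List ℕ → ℕ
#parts λs = length (filter (λ x → x ≟ σ λs) λs)

-- spt_{(1,1)}(n,k) = Σ_λ σ(λ)^1 #(λ)^1 over partitions λ of n into exactly k parts.
spt11 : ℕ → ℕ → ℕ
spt11 n k = sum (map (λ λs → σ λs * #parts λs) (partitions n k))

Σ[1to_] : ℕ → (ℕ → ℕ) → ℕ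
Σ[1to N ] f = sum (map f (applyUpTo suc N))

-- Peel off the largest part a of a partition a ∷ μ into suc k parts of size ≤ b: the weight
-- σ·# of a ∷ μ is that of μ, plus a exactly when a is also a smallest part, i.e. when a ∷ μ is
-- constant. Induction on k then gives, over partitions of n into k parts ≤ b,
--   Σ σ·# = Σ_{m=1}^{b} m · multiplicitySum (n − km) k (b − m),
--   multiplicitySum N k c = Σ_{ν<k} (k − ν) · #{partitions of N into ν parts ≤ c},
-- since deleting the k − ν copies of the smallest part m and subtracting m from the other parts
-- leaves a partition of n − km into ν parts ≤ b − m. For b = n only m ≤ ⌊n/k⌋ contributes and the
-- bound b − m is vacuous. The ν = 0 term contributes k for the constant partition (m, …, m); in
-- the paper's sum the convention p(0,1) = 1 supplies k − 1 of it and ⌊n/k⌋⌊k⌊n/k⌋/n⌋ the rest.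
{-# OPTIONS --safe #-}
module Submission where

open import Defs
open import Data.Nat using (ℕ; NonZero; _+_; _*_; _∸_)
open import Data.Nat.DivMod using (_/_)
open import Relation.Binary.PropositionalEquality using (_≡_)

open import Data.List using (List; []; _∷_; _++_; map; concatMap; filter; applyUpTo; length; foldr)
open import Data.List.Properties using (map-++; map-∘; map-cong)
open import Data.Nat using (zero; suc; _≤_; _<_; _⊓_; _≤?_; _≟_; z≤n; z<s; s<s)
open import Data.Nat.DivMod using (m*n/n≡m; m/n*n≤m; m/n≤m; /-monoˡ-≤; /-congˡ; n/n≡1; m<n⇒m/n≡0)
open import Data.Nat.ListAction using (sum)
open import Data.Nat.ListAction.Properties using (sum-++)
open import Data.Nat.Properties
open import Algebra.Properties.CommutativeSemigroup +-commutativeSemigroup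
  using (interchange; xy∙z≈xz∙y)
open import Algebra.Properties.CommutativeSemigroup ⊓-commutativeSemigroup
  using (x∙yz≈y∙xz)
open import Data.Nat.Tactic.RingSolver using (solve-∀)
open import Data.Unit using (⊤; tt)
open import Function using (_∘_)
open import Relation.Nullary using (Dec; yes; no; ¬_; contradiction)
open import Relation.Binary.PropositionalEquality
  using (_≢_; refl; sym; trans; cong; cong₂; subst; module ≡-Reasoning)
open ≡-Reasoning

private variable
  A B : Set

infixr 8 [_]·_

[_]·_ : Dec A → ℕ → ℕ
[ yes _ ]· x = x
[ no _  ]· x = 0

[]·-yes : (a? : Dec A) → A → ∀ x → [ a? ]· x ≡ x
[]·-yes (yes _) _ _ = refl
[]·-yes (no ¬a) a _ = contradiction a ¬a

[]·-no : (a? : Dec A) → ¬ A → ∀ x → [ a? ]· x ≡ 0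
[]·-no (yes a) ¬a _ = contradiction a ¬a
[]·-no (no _)  _  _ = refl

[]·-⇔ : (a? : Dec A) (b? : Dec B) → (A → B) → (B → A) → ∀ x → [ a? ]· x ≡ [ b? ]· x
[]·-⇔ (yes _) (yes _) _   _   _ = refl
[]·-⇔ (no _)  (no _)  _   _   _ = refl
[]·-⇔ (yes a) (no ¬b) a→b _   _ = contradiction (a→b a) ¬b
[]·-⇔ (no ¬a) (yes b) _   b→a _ = contradiction (b→a b) ¬a

[]·-0 : (a? : Dec A) → [ a? ]· 0 ≡ 0
[]·-0 (yes _) = refl
[]·-0 (no _)  = refl

[]·-distrib-+ : (a? : Dec A) → ∀ x y → [ a? ]· (x + y) ≡ [ a? ]· x + [ a? ]· y
[]·-distrib-+ (yes _) _ _ = refl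
[]·-distrib-+ (no _)  _ _ = refl

[]·-* : (a? : Dec A) → ∀ x y → [ a? ]· (x * y) ≡ x * [ a? ]· y
[]·-* (yes _) x y = refl
[]·-* (no _)  x y = sym (*-zeroʳ x)

[]·≡*[]·1 : (a? : Dec A) → ∀ x → [ a? ]· x ≡ x * [ a? ]· 1
[]·≡*[]·1 (yes _) x = sym (*-identityʳ x)
[]·≡*[]·1 (no _)  x = sym (*-zeroʳ x)

[≤]·[≤∸] : ∀ a b n x → [ a ≤? n ]· [ b ≤? n ∸ a ]· x ≡ [ a + b ≤? n ]· x
[≤]·[≤∸] a b n x with a ≤? n
... | yes a≤n = []·-⇔ (b ≤? n ∸ a) (a + b ≤? n)
                  (λ b≤n∸a → subst (_≤ n) (+-comm b a) (m≤o∸n⇒m+n≤o b a≤n b≤n∸a))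
                  (λ a+b≤n → m+n≤o⇒m≤o∸n b (subst (_≤ n) (+-comm a b) a+b≤n)) x
... | no a≰n = sym ([]·-no (a + b ≤? n) (a≰n ∘ m+n≤o⇒m≤o a) x)

[≤]·[∸≟] : ∀ a b n x → [ a ≤? n ]· [ n ∸ a ≟ b ]· x ≡ [ n ≟ a + b ]· x
[≤]·[∸≟] a b n x with a ≤? n
... | yes a≤n = []·-⇔ (n ∸ a ≟ b) (n ≟ a + b)
                  (λ e → trans (sym (m+[n∸m]≡n a≤n)) (cong (a +_) e))
                  (λ e → trans (cong (_∸ a) e) (m+n∸m≡n a b)) x
... | no a≰n = sym ([]·-no (n ≟ a + b) (λ e → a≰n (≤-trans (m≤m+n a b) (≤-reflexive (sym e)))) x)

∑ : ℕ → (ℕ → ℕ) → ℕ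
∑ zero    f = 0
∑ (suc n) f = f 0 + ∑ n (f ∘ suc)

∑-cong : ∀ n {f g : ℕ → ℕ} → (∀ i → i < n → f i ≡ g i) → ∑ n f ≡ ∑ n g
∑-cong zero    _   = refl
∑-cong (suc n) f≡g = cong₂ _+_ (f≡g 0 z<s) (∑-cong n (λ i i<n → f≡g (suc i) (s<s i<n)))

∑-zero : ∀ n {f : ℕ → ℕ} → (∀ i → i < n → f i ≡ 0) → ∑ n f ≡ 0
∑-zero zero    _   = refl
∑-zero (suc n) f≡0 = cong₂ _+_ (f≡0 0 z<s) (∑-zero n (λ i i<n → f≡0 (suc i) (s<s i<n)))

∑-last : ∀ n {f : ℕ → ℕ} → (∀ i → i < n → f i ≡ 0) → ∑ (suc n) f ≡ f n
∑-last zero    _   = +-identityʳ _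
∑-last (suc n) f≡0 = cong₂ _+_ (f≡0 0 z<s) (∑-last n (λ i i<n → f≡0 (suc i) (s<s i<n)))

∑-distrib-+ : ∀ n (f g : ℕ → ℕ) → ∑ n (λ i → f i + g i) ≡ ∑ n f + ∑ n g
∑-distrib-+ zero    f g = refl
∑-distrib-+ (suc n) f g =
  trans (cong (f 0 + g 0 +_) (∑-distrib-+ n (f ∘ suc) (g ∘ suc))) (interchange (f 0) (g 0) _ _)

∑-distribˡ-* : ∀ n c (f : ℕ → ℕ) → ∑ n (λ i → c * f i) ≡ c * ∑ n f
∑-distribˡ-* zero    c f = sym (*-zeroʳ c)
∑-distribˡ-* (suc n) c f =
  trans (cong (c * f 0 +_) (∑-distribˡ-* n c (f ∘ suc))) (sym (*-distribˡ-+ c (f 0) _))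

[]·-∑ : (a? : Dec A) → ∀ n (f : ℕ → ℕ) → [ a? ]· ∑ n f ≡ ∑ n (λ i → [ a? ]· f i)
[]·-∑ (yes _) n f = refl
[]·-∑ (no _)  n f = sym (∑-zero n (λ _ _ → refl))

∑-split : ∀ m r (f : ℕ → ℕ) → ∑ (m + r) f ≡ ∑ m f + ∑ r (λ i → f (m + i))
∑-split zero    r f = refl
∑-split (suc m) r f = trans (cong (f 0 +_) (∑-split m r (f ∘ suc))) (sym (+-assoc (f 0) _ _))

∑-trim : ∀ {m n} (f : ℕ → ℕ) → m ≤ n → (∀ i → m ≤ i → f i ≡ 0) → ∑ n f ≡ ∑ m f
∑-trim {m} {n} f m≤n f≡0 = begin
  ∑ n f                                ≡⟨ cong (λ l → ∑ l f) (sym (m+[n∸m]≡n m≤n)) ⟩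
  ∑ (m + (n ∸ m)) f                    ≡⟨ ∑-split m (n ∸ m) f ⟩
  ∑ m f + ∑ (n ∸ m) (λ i → f (m + i))  ≡⟨ cong (∑ m f +_) (∑-zero (n ∸ m) (λ i _ → f≡0 _ (m≤m+n m i))) ⟩
  ∑ m f + 0                            ≡⟨ +-identityʳ _ ⟩
  ∑ m f                                ∎

∑-comm : ∀ m n (h : ℕ → ℕ → ℕ) → ∑ m (λ i → ∑ n (h i)) ≡ ∑ n (λ j → ∑ m (λ i → h i j))
∑-comm zero    n h = sym (∑-zero n (λ _ _ → refl))
∑-comm (suc m) n h =
  trans (cong (∑ n (h 0) +_) (∑-comm m n (h ∘ suc))) (sym (∑-distrib-+ n (h 0) _))

∑-comm-triangle : ∀ b (h : ℕ → ℕ → ℕ) →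
  ∑ b (λ i → ∑ (suc i) (h i)) ≡ ∑ b (λ j → ∑ (b ∸ j) (λ d → h (j + d) j))
∑-comm-triangle zero    h = refl
∑-comm-triangle (suc b) h = begin
  ∑ (suc b) (λ i → ∑ (suc i) (h i))
    ≡⟨ cong (_+ ∑ b (λ i → ∑ (suc (suc i)) (h (suc i)))) (+-identityʳ (h 0 0)) ⟩
  h 0 0 + ∑ b (λ i → h (suc i) 0 + ∑ (suc i) (λ j → h (suc i) (suc j)))
    ≡⟨ cong (h 0 0 +_) (∑-distrib-+ b _ _) ⟩
  h 0 0 + (∑ b (λ i → h (suc i) 0) + ∑ b (λ i → ∑ (suc i) (λ j → h (suc i) (suc j))))
    ≡⟨ cong (λ t → h 0 0 + (∑ b (λ i → h (suc i) 0) + t)) (∑-comm-triangle b (λ i j → h (suc i) (suc j))) ⟩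
  h 0 0 + (∑ b (λ i → h (suc i) 0) + ∑ b (λ j → ∑ (b ∸ j) (λ d → h (suc (j + d)) (suc j))))
    ≡⟨ sym (+-assoc (h 0 0) _ _) ⟩
  ∑ (suc b) (λ j → ∑ (suc b ∸ j) (λ d → h (j + d) j))
    ∎

sum-map-applyUpTo : ∀ (f g : ℕ → ℕ) n → sum (map f (applyUpTo g n)) ≡ ∑ n (f ∘ g)
sum-map-applyUpTo f g zero    = refl
sum-map-applyUpTo f g (suc n) = cong (f (g 0) +_) (sum-map-applyUpTo f (g ∘ suc) n)

sum-map-zero : ∀ {f : A → ℕ} → (∀ x → f x ≡ 0) → ∀ xs → sum (map f xs) ≡ 0
sum-map-zero f≡0 []       = refl
sum-map-zero f≡0 (x ∷ xs) = cong₂ _+_ (f≡0 x) (sum-map-zero f≡0 xs)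

sum-map-+ : ∀ (f g : A → ℕ) xs → sum (map (λ x → f x + g x) xs) ≡ sum (map f xs) + sum (map g xs)
sum-map-+ f g []       = refl
sum-map-+ f g (x ∷ xs) =
  trans (cong (f x + g x +_) (sum-map-+ f g xs)) (interchange (f x) (g x) _ _)

sum-map-concatMap : ∀ (f : B → ℕ) (g : A → List B) xs →
  sum (map f (concatMap g xs)) ≡ sum (map (sum ∘ map f ∘ g) xs)
sum-map-concatMap f g []       = refl
sum-map-concatMap f g (x ∷ xs) = begin
  sum (map f (g x ++ concatMap g xs))
    ≡⟨ cong sum (map-++ f (g x) _) ⟩
  sum (map f (g x) ++ map f (concatMap g xs))
    ≡⟨ sum-++ (map f (g x)) _ ⟩
  sum (map f (g x)) + sum (map f (concatMap g xs))
    ≡⟨ cong (sum (map f (g x)) +_) (sum-map-concatMap f g xs) ⟩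
  sum (map (sum ∘ map f ∘ g) (x ∷ xs))
    ∎

sum-map-filter : ∀ {P : A → Set} (P? : ∀ x → Dec (P x)) (f : A → ℕ) xs →
  sum (map f (filter P? xs)) ≡ sum (map (λ x → [ P? x ]· f x) xs)
sum-map-filter P? f []       = refl
sum-map-filter P? f (x ∷ xs) with P? x
... | yes _ = cong (f x +_) (sum-map-filter P? f xs)
... | no _  = sum-map-filter P? f xs

length-filter-∷ : ∀ {P : A → Set} (P? : ∀ x → Dec (P x)) x xs →
  length (filter P? (x ∷ xs)) ≡ [ P? x ]· 1 + length (filter P? xs)
length-filter-∷ P? x xs with P? x
... | yes _ = refl
... | no _  = refl

length≡sum-map-1 : ∀ (xs : List A) → length xs ≡ sum (map (λ _ → 1) xs)
length≡sum-map-1 []       = refl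
length≡sum-map-1 (x ∷ xs) = cong suc (length≡sum-map-1 xs)

foldr-⊓ : ∀ a z xs → foldr _⊓_ (a ⊓ z) xs ≡ a ⊓ foldr _⊓_ z xs
foldr-⊓ a z []       = refl
foldr-⊓ a z (y ∷ ys) = trans (cong (y ⊓_) (foldr-⊓ a z ys)) (x∙yz≈y∙xz y a _)

σ-∷-∷ : ∀ a y ys → σ (a ∷ y ∷ ys) ≡ a ⊓ σ (y ∷ ys)
σ-∷-∷ a y ys = begin
  y ⊓ foldr _⊓_ a ys   ≡⟨ foldr-⊓ y a ys ⟨
  foldr _⊓_ (y ⊓ a) ys ≡⟨ cong (λ t → foldr _⊓_ t ys) (⊓-comm y a) ⟩
  foldr _⊓_ (a ⊓ y) ys ≡⟨ foldr-⊓ a y ys ⟩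
  a ⊓ foldr _⊓_ y ys   ∎

σ≤head : ∀ y ys → σ (y ∷ ys) ≤ y
σ≤head y []       = ≤-refl
σ≤head y (z ∷ zs) = ≤-trans (m⊓n≤n z _) (σ≤head y zs)

σ-∷-≥ : ∀ {a y} ys → y ≤ a → σ (a ∷ y ∷ ys) ≡ σ (y ∷ ys)
σ-∷-≥ {a} {y} ys y≤a = trans (σ-∷-∷ a y ys) (m≥n⇒m⊓n≡n (≤-trans (σ≤head y ys) y≤a))

σ-∷-∷-< : ∀ {a y} ys → y < a → σ (a ∷ y ∷ ys) < a
σ-∷-∷-< {a} {y} ys y<a = ≤-<-trans (m⊓n≤m y _) y<a

Head≤ : ℕ → List ℕ → Set
Head≤ b []      = ⊤
Head≤ b (y ∷ _) = y ≤ b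

pBounded : ℕ → ℕ → ℕ → ℕ
pBounded n k b = length (partsBounded n k b)

weight : List ℕ → ℕ
weight λs = σ λs * #parts λs

sptBounded : ℕ → ℕ → ℕ → ℕ
sptBounded n k b = sum (map weight (partsBounded n k b))

sum-partsBounded-zero : ∀ (f : List ℕ → ℕ) n b → sum (map f (partsBounded n 0 b)) ≡ [ n ≟ 0 ]· f []
sum-partsBounded-zero f n b with n ≟ 0
... | yes _ = +-identityʳ (f [])
... | no _  = refl

sum-partsBounded-suc : ∀ (f : List ℕ → ℕ) n k b →
  sum (map f (partsBounded n (suc k) b))
    ≡ ∑ b (λ i → [ suc i ≤? n ]· sum (map (f ∘ (suc i ∷_)) (partsBounded (n ∸ suc i) k (suc i))))
sum-partsBounded-suc f n k b = begin
  sum (map f (concatMap branch (filter (_≤? n) (applyUpTo suc b))))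
    ≡⟨ sum-map-concatMap f branch (filter (_≤? n) (applyUpTo suc b)) ⟩
  sum (map (sum ∘ map f ∘ branch) (filter (_≤? n) (applyUpTo suc b)))
    ≡⟨ sum-map-filter (_≤? n) _ (applyUpTo suc b) ⟩
  sum (map (λ a → [ a ≤? n ]· sum (map f (branch a))) (applyUpTo suc b))
    ≡⟨ sum-map-applyUpTo _ suc b ⟩
  ∑ b (λ i → [ suc i ≤? n ]· sum (map f (branch (suc i))))
    ≡⟨ ∑-cong b (λ i _ → cong (λ xs → [ suc i ≤? n ]· sum xs) (sym (map-∘ (tails i)))) ⟩
  ∑ b (λ i → [ suc i ≤? n ]· sum (map (f ∘ (suc i ∷_)) (partsBounded (n ∸ suc i) k (suc i))))
    ∎
  where
  tails : ℕ → List (List ℕ)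
  tails i = partsBounded (n ∸ suc i) k (suc i)
  branch : ℕ → List (List ℕ)
  branch a = map (a ∷_) (partsBounded (n ∸ a) k a)

sum-partsBounded-cong : ∀ n k b {f g : List ℕ → ℕ} → (∀ μ → Head≤ b μ → f μ ≡ g μ) →
  sum (map f (partsBounded n k b)) ≡ sum (map g (partsBounded n k b))
sum-partsBounded-cong n zero b {f} {g} f≡g = begin
  sum (map f (partsBounded n 0 b)) ≡⟨ sum-partsBounded-zero f n b ⟩
  [ n ≟ 0 ]· f []                  ≡⟨ cong ([ n ≟ 0 ]·_) (f≡g [] tt) ⟩
  [ n ≟ 0 ]· g []                  ≡⟨ sum-partsBounded-zero g n b ⟨
  sum (map g (partsBounded n 0 b)) ∎
sum-partsBounded-cong n (suc k) b {f} {g} f≡g = begin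
  sum (map f (partsBounded n (suc k) b))
    ≡⟨ sum-partsBounded-suc f n k b ⟩
  ∑ b (λ i → [ suc i ≤? n ]· sum (map (f ∘ (suc i ∷_)) (partsBounded (n ∸ suc i) k (suc i))))
    ≡⟨ ∑-cong b (λ i i<b → cong (λ xs → [ suc i ≤? n ]· sum xs)
                              (map-cong (λ μ → f≡g (suc i ∷ μ) i<b) (partsBounded (n ∸ suc i) k (suc i)))) ⟩
  ∑ b (λ i → [ suc i ≤? n ]· sum (map (g ∘ (suc i ∷_)) (partsBounded (n ∸ suc i) k (suc i))))
    ≡⟨ sum-partsBounded-suc g n k b ⟨
  sum (map g (partsBounded n (suc k) b))
    ∎

pBounded-zero : ∀ n b → pBounded n 0 b ≡ [ n ≟ 0 ]· 1
pBounded-zero n b = trans (length≡sum-map-1 (partsBounded n 0 b)) (sum-partsBounded-zero (λ _ → 1) n b)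

pBounded-suc : ∀ n k b → pBounded n (suc k) b ≡ ∑ b (λ i → [ suc i ≤? n ]· pBounded (n ∸ suc i) k (suc i))
pBounded-suc n k b = begin
  pBounded n (suc k) b
    ≡⟨ length≡sum-map-1 (partsBounded n (suc k) b) ⟩
  sum (map (λ _ → 1) (partsBounded n (suc k) b))
    ≡⟨ sum-partsBounded-suc (λ _ → 1) n k b ⟩
  ∑ b (λ i → [ suc i ≤? n ]· sum (map (λ _ → 1) (partsBounded (n ∸ suc i) k (suc i))))
    ≡⟨ ∑-cong b (λ i _ → cong ([ suc i ≤? n ]·_) (sym (length≡sum-map-1 (tails i)))) ⟩
  ∑ b (λ i → [ suc i ≤? n ]· pBounded (n ∸ suc i) k (suc i))
    ∎
  where
  tails : ℕ → List (List ℕ)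
  tails i = partsBounded (n ∸ suc i) k (suc i)

pBounded-large-bound : ∀ N ν {c} → N ≤ c → pBounded N ν c ≡ pBounded N ν N
pBounded-large-bound N zero    {c} _   = trans (pBounded-zero N c) (sym (pBounded-zero N N))
pBounded-large-bound N (suc ν) {c} N≤c = begin
  pBounded N (suc ν) c  ≡⟨ pBounded-suc N ν c ⟩
  ∑ c part              ≡⟨ ∑-trim part N≤c (λ i N≤i → []·-no (suc i ≤? N) (<⇒≱′ N≤i) _) ⟩
  ∑ N part              ≡⟨ pBounded-suc N ν N ⟨
  pBounded N (suc ν) N  ∎
  where
  part : ℕ → ℕ
  part i = [ suc i ≤? N ]· pBounded (N ∸ suc i) ν (suc i)
  <⇒≱′ : ∀ {i} → N ≤ i → ¬ (i < N)
  <⇒≱′ N≤i i<N = <⇒≱ i<N N≤i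

*[≟]·1 : ∀ s a → s * [ a ≟ s ]· 1 ≡ [ a ≟ s ]· a
*[≟]·1 s a with a ≟ s
... | yes refl = *-identityʳ s
... | no _     = *-zeroʳ s

weight-∷ : ∀ a μ → Head≤ a μ → weight (a ∷ μ) ≡ weight μ + [ a ≟ σ (a ∷ μ) ]· a
weight-∷ a μ a≥μ = begin
  s * length (filter (_≟ s) (a ∷ μ))
    ≡⟨ cong (s *_) (length-filter-∷ (_≟ s) a μ) ⟩
  s * ([ a ≟ s ]· 1 + length (filter (_≟ s) μ))
    ≡⟨ *-distribˡ-+ s _ _ ⟩
  s * [ a ≟ s ]· 1 + s * length (filter (_≟ s) μ)
    ≡⟨ cong₂ _+_ (*[≟]·1 s a) (tail-weight μ a≥μ) ⟩
  [ a ≟ s ]· a + weight μ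
    ≡⟨ +-comm _ (weight μ) ⟩
  weight μ + [ a ≟ s ]· a
    ∎
  where
  s = σ (a ∷ μ)
  tail-weight : ∀ μ → Head≤ a μ → σ (a ∷ μ) * length (filter (_≟ σ (a ∷ μ)) μ) ≡ weight μ
  tail-weight []       _   = *-zeroʳ a
  tail-weight (y ∷ ys) y≤a = cong (λ t → t * length (filter (_≟ t) (y ∷ ys))) (σ-∷-≥ ys y≤a)

sum-partsBounded-σ≡bound : ∀ k N a x →
  sum (map (λ μ → [ suc a ≟ σ (suc a ∷ μ) ]· x) (partsBounded N k (suc a))) ≡ [ N ≟ k * suc a ]· x
sum-partsBounded-σ≡bound zero N a x =
  trans (sum-partsBounded-zero _ N (suc a)) (cong ([ N ≟ 0 ]·_) ([]·-yes (suc a ≟ suc a) refl x))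
sum-partsBounded-σ≡bound (suc k) N a x = begin
  sum (map σ≡a (partsBounded N (suc k) (suc a)))
    ≡⟨ sum-partsBounded-suc σ≡a N k (suc a) ⟩
  ∑ (suc a) (λ i → [ suc i ≤? N ]· sum (map (σ≡a ∘ (suc i ∷_)) (partsBounded (N ∸ suc i) k (suc i))))
    ≡⟨ ∑-last a smaller-largest-part ⟩
  [ suc a ≤? N ]· sum (map (σ≡a ∘ (suc a ∷_)) (partsBounded (N ∸ suc a) k (suc a)))
    ≡⟨ cong ([ suc a ≤? N ]·_) (cong sum (map-cong equal-head (partsBounded (N ∸ suc a) k (suc a)))) ⟩
  [ suc a ≤? N ]· sum (map σ≡a (partsBounded (N ∸ suc a) k (suc a)))
    ≡⟨ cong ([ suc a ≤? N ]·_) (sum-partsBounded-σ≡bound k (N ∸ suc a) a x) ⟩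
  [ suc a ≤? N ]· [ N ∸ suc a ≟ k * suc a ]· x
    ≡⟨ [≤]·[∸≟] (suc a) (k * suc a) N x ⟩
  [ N ≟ suc k * suc a ]· x
    ∎
  where
  tails : ℕ → List (List ℕ)
  tails i = partsBounded (N ∸ suc i) k (suc i)
  σ≡a : List ℕ → ℕ
  σ≡a μ = [ suc a ≟ σ (suc a ∷ μ) ]· x
  smaller-head : ∀ {i} → i < a → ∀ μ → σ≡a (suc i ∷ μ) ≡ 0
  smaller-head i<a μ = []·-no (suc a ≟ _) (λ a≡σ → <-irrefl (sym a≡σ) (σ-∷-∷-< μ (s<s i<a))) x
  smaller-largest-part : ∀ i → i < a → [ suc i ≤? N ]· sum (map (σ≡a ∘ (suc i ∷_)) (tails i)) ≡ 0
  smaller-largest-part i i<a =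
    trans (cong ([ suc i ≤? N ]·_) (sum-map-zero (smaller-head i<a) (tails i))) ([]·-0 (suc i ≤? N))
  equal-head : ∀ μ → σ≡a (suc a ∷ μ) ≡ σ≡a μ
  equal-head μ = cong (λ t → [ suc a ≟ t ]· x) (σ-∷-≥ μ ≤-refl)

sptBounded-suc : ∀ n k b →
  sptBounded n (suc k) b
    ≡ ∑ b (λ i → [ suc i ≤? n ]· sptBounded (n ∸ suc i) k (suc i)) + ∑ b (λ i → [ n ≟ suc k * suc i ]· suc i)
sptBounded-suc n k b = begin
  sptBounded n (suc k) b
    ≡⟨ sum-partsBounded-suc weight n k b ⟩
  ∑ b (λ i → [ suc i ≤? n ]· sum (map (weight ∘ (suc i ∷_)) (rest i)))
    ≡⟨ ∑-cong b (λ i _ → largest-part i) ⟩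
  ∑ b (λ i → [ suc i ≤? n ]· sptBounded (n ∸ suc i) k (suc i) + [ n ≟ suc k * suc i ]· suc i)
    ≡⟨ ∑-distrib-+ b _ _ ⟩
  ∑ b (λ i → [ suc i ≤? n ]· sptBounded (n ∸ suc i) k (suc i)) + ∑ b (λ i → [ n ≟ suc k * suc i ]· suc i)
    ∎
  where
  rest : ℕ → List (List ℕ)
  rest i = partsBounded (n ∸ suc i) k (suc i)
  largest-part : ∀ i → [ suc i ≤? n ]· sum (map (weight ∘ (suc i ∷_)) (rest i))
                         ≡ [ suc i ≤? n ]· sptBounded (n ∸ suc i) k (suc i) + [ n ≟ suc k * suc i ]· suc i
  largest-part i = begin
    [ suc i ≤? n ]· sum (map (weight ∘ (suc i ∷_)) (rest i))
      ≡⟨ cong ([ suc i ≤? n ]·_) (sum-partsBounded-cong (n ∸ suc i) k (suc i) (weight-∷ (suc i))) ⟩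
    [ suc i ≤? n ]· sum (map (λ μ → weight μ + σ≡i μ) (rest i))
      ≡⟨ cong ([ suc i ≤? n ]·_) (sum-map-+ weight σ≡i (rest i)) ⟩
    [ suc i ≤? n ]· (sptBounded (n ∸ suc i) k (suc i) + sum (map σ≡i (rest i)))
      ≡⟨ []·-distrib-+ (suc i ≤? n) _ _ ⟩
    spt-rest + [ suc i ≤? n ]· sum (map σ≡i (rest i))
      ≡⟨ cong (spt-rest +_) (cong ([ suc i ≤? n ]·_) (sum-partsBounded-σ≡bound k (n ∸ suc i) i (suc i))) ⟩
    spt-rest + [ suc i ≤? n ]· [ n ∸ suc i ≟ k * suc i ]· suc i
      ≡⟨ cong (spt-rest +_) ([≤]·[∸≟] (suc i) (k * suc i) n (suc i)) ⟩
    [ suc i ≤? n ]· sptBounded (n ∸ suc i) k (suc i) + [ n ≟ suc k * suc i ]· suc i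
      ∎
    where
    spt-rest = [ suc i ≤? n ]· sptBounded (n ∸ suc i) k (suc i)
    σ≡i : List ℕ → ℕ
    σ≡i μ = [ suc i ≟ σ (suc i ∷ μ) ]· suc i

multiplicitySum : ℕ → ℕ → ℕ → ℕ
multiplicitySum N k c = ∑ k (λ ν → (k ∸ ν) * pBounded N ν c)

multiplicitySum-0 : ∀ N k → multiplicitySum N k 0 ≡ k * [ N ≟ 0 ]· 1
multiplicitySum-0 N zero    = refl
multiplicitySum-0 N (suc k) = begin
  suc k * pBounded N 0 0 + ∑ k (λ ν → (k ∸ ν) * pBounded N (suc ν) 0)
    ≡⟨ cong₂ _+_ (cong (suc k *_) (pBounded-zero N 0)) (∑-zero k (λ ν _ → *-zeroʳ (k ∸ ν))) ⟩
  suc k * [ N ≟ 0 ]· 1 + 0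
    ≡⟨ +-identityʳ _ ⟩
  suc k * [ N ≟ 0 ]· 1
    ∎

multiplicitySum-suc : ∀ N k c →
  multiplicitySum N (suc k) c ≡ ∑ (suc c) (λ d → [ d ≤? N ]· multiplicitySum (N ∸ d) k d) + [ N ≟ 0 ]· 1
multiplicitySum-suc N k c = begin
  suc k * pBounded N 0 c + ∑ k (λ ν → (k ∸ ν) * pBounded N (suc ν) c)
    ≡⟨ cong₂ _+_ (cong (suc k *_) (pBounded-zero N c)) remove-largest ⟩
  suc k * Z + M
    ≡⟨ rearrange k Z M ⟩
  (k * Z + M) + Z
    ≡⟨ cong (λ t → t + M + Z) (sym (trans ([]·-yes (0 ≤? N) z≤n _) (multiplicitySum-0 N k))) ⟩
  [ 0 ≤? N ]· multiplicitySum N k 0 + M + Z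
    ∎
  where
  Z = [ N ≟ 0 ]· 1
  M = ∑ c (λ i → [ suc i ≤? N ]· multiplicitySum (N ∸ suc i) k (suc i))
  rearrange : ∀ k z m → suc k * z + m ≡ (k * z + m) + z
  rearrange = solve-∀
  remove-largest : ∑ k (λ ν → (k ∸ ν) * pBounded N (suc ν) c) ≡ M
  remove-largest = begin
    ∑ k (λ ν → (k ∸ ν) * pBounded N (suc ν) c)
      ≡⟨ ∑-cong k (λ ν _ → trans (cong ((k ∸ ν) *_) (pBounded-suc N ν c)) (sym (∑-distribˡ-* c (k ∸ ν) _))) ⟩
    ∑ k (λ ν → ∑ c (λ i → (k ∸ ν) * [ suc i ≤? N ]· pBounded (N ∸ suc i) ν (suc i)))
      ≡⟨ ∑-comm k c _ ⟩
    ∑ c (λ i → ∑ k (λ ν → (k ∸ ν) * [ suc i ≤? N ]· pBounded (N ∸ suc i) ν (suc i)))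
      ≡⟨ ∑-cong c (λ i _ → trans (∑-cong k (λ ν _ → sym ([]·-* (suc i ≤? N) (k ∸ ν) _)))
                                  (sym ([]·-∑ (suc i ≤? N) k _))) ⟩
    M ∎

multiplicitySum-shift : ∀ s n k c →
  ∑ (suc c) (λ d → [ s + d ≤? n ]· multiplicitySum (n ∸ (s + d)) k d) + [ n ≟ s ]· 1
    ≡ [ s ≤? n ]· multiplicitySum (n ∸ s) (suc k) c
multiplicitySum-shift s n k c = begin
  ∑ (suc c) (λ d → [ s + d ≤? n ]· multiplicitySum (n ∸ (s + d)) k d) + [ n ≟ s ]· 1
    ≡⟨ cong₂ _+_ (∑-cong (suc c) (λ d _ → split-guard d)) split-guard-0 ⟩
  ∑ (suc c) (λ d → [ s ≤? n ]· rest d) + [ s ≤? n ]· [ n ∸ s ≟ 0 ]· 1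
    ≡⟨ cong (_+ [ s ≤? n ]· [ n ∸ s ≟ 0 ]· 1) ([]·-∑ (s ≤? n) (suc c) rest) ⟨
  [ s ≤? n ]· ∑ (suc c) rest + [ s ≤? n ]· [ n ∸ s ≟ 0 ]· 1
    ≡⟨ []·-distrib-+ (s ≤? n) _ _ ⟨
  [ s ≤? n ]· (∑ (suc c) rest + [ n ∸ s ≟ 0 ]· 1)
    ≡⟨ cong ([ s ≤? n ]·_) (multiplicitySum-suc (n ∸ s) k c) ⟨
  [ s ≤? n ]· multiplicitySum (n ∸ s) (suc k) c
    ∎
  where
  rest : ℕ → ℕ
  rest d = [ d ≤? n ∸ s ]· multiplicitySum (n ∸ s ∸ d) k d
  split-guard : ∀ d → [ s + d ≤? n ]· multiplicitySum (n ∸ (s + d)) k d ≡ [ s ≤? n ]· rest d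
  split-guard d = trans (cong (λ t → [ s + d ≤? n ]· multiplicitySum t k d) (sym (∸-+-assoc n s d)))
                        (sym ([≤]·[≤∸] s d n _))
  split-guard-0 : [ n ≟ s ]· 1 ≡ [ s ≤? n ]· [ n ∸ s ≟ 0 ]· 1
  split-guard-0 = trans (cong (λ t → [ n ≟ t ]· 1) (sym (+-identityʳ s))) (sym ([≤]·[∸≟] s 0 n 1))

-- The summand of the largest part suc i and the smallest part suc j of a partition into suc k parts.
summand : ℕ → ℕ → ℕ → ℕ → ℕ
summand n k i j = suc j * [ suc i + k * suc j ≤? n ]· multiplicitySum (n ∸ (suc i + k * suc j)) k (suc i ∸ suc j)

∑-summand : ∀ n k j b → j < b →
  ∑ (b ∸ j) (λ d → summand n k (j + d) j) + [ n ≟ suc k * suc j ]· suc j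
    ≡ suc j * [ suc k * suc j ≤? n ]· multiplicitySum (n ∸ suc k * suc j) (suc k) (b ∸ suc j)
∑-summand n k j b j<b = begin
  ∑ (b ∸ j) (λ d → summand n k (j + d) j) + [ n ≟ s ]· m
    ≡⟨ cong₂ _+_ (trans (cong (λ l → ∑ l (λ d → summand n k (j + d) j)) (+-∸-assoc 1 j<b))
                        (∑-cong (suc c) (λ d _ → reindex d)))
                 ([]·≡*[]·1 (n ≟ s) m) ⟩
  ∑ (suc c) (λ d → m * shifted d) + m * [ n ≟ s ]· 1
    ≡⟨ cong (_+ m * [ n ≟ s ]· 1) (∑-distribˡ-* (suc c) m shifted) ⟩
  m * ∑ (suc c) shifted + m * [ n ≟ s ]· 1
    ≡⟨ *-distribˡ-+ m (∑ (suc c) shifted) ([ n ≟ s ]· 1) ⟨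
  m * (∑ (suc c) shifted + [ n ≟ s ]· 1)
    ≡⟨ cong (m *_) (multiplicitySum-shift s n k c) ⟩
  m * [ s ≤? n ]· multiplicitySum (n ∸ s) (suc k) c
    ∎
  where
  m = suc j
  s = suc k * m
  c = b ∸ m
  shifted : ℕ → ℕ
  shifted d = [ s + d ≤? n ]· multiplicitySum (n ∸ (s + d)) k d
  reindex : ∀ d → summand n k (j + d) j ≡ m * shifted d
  reindex d = cong₂ (λ t u → m * [ t ≤? n ]· multiplicitySum (n ∸ t) k u)
                    (cong suc (xy∙z≈xz∙y j d (k * m))) (m+n∸m≡n j d)

sptBounded-formula : ∀ k n b →
  sptBounded n k b ≡ ∑ b (λ j → suc j * [ k * suc j ≤? n ]· multiplicitySum (n ∸ k * suc j) k (b ∸ suc j))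
sptBounded-formula zero n b = begin
  sptBounded n 0 b                  ≡⟨ sum-partsBounded-zero weight n b ⟩
  [ n ≟ 0 ]· 0                      ≡⟨ []·-0 (n ≟ 0) ⟩
  0                                 ≡⟨ ∑-zero b (λ j _ → trans (cong (suc j *_) ([]·-0 (0 ≤? n))) (*-zeroʳ (suc j))) ⟨
  ∑ b (λ j → suc j * [ 0 ≤? n ]· 0) ∎
sptBounded-formula (suc k) n b = begin
  sptBounded n (suc k) b
    ≡⟨ sptBounded-suc n k b ⟩
  ∑ b (λ i → [ suc i ≤? n ]· sptBounded (n ∸ suc i) k (suc i)) + ∑ b all-equal
    ≡⟨ cong (_+ ∑ b all-equal) (trans (∑-cong b (λ i _ → guarded-IH i)) (∑-comm-triangle b (summand n k))) ⟩
  ∑ b (λ j → ∑ (b ∸ j) (λ d → summand n k (j + d) j)) + ∑ b all-equal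
    ≡⟨ ∑-distrib-+ b _ _ ⟨
  ∑ b (λ j → ∑ (b ∸ j) (λ d → summand n k (j + d) j) + all-equal j)
    ≡⟨ ∑-cong b (λ j → ∑-summand n k j b) ⟩
  ∑ b (λ j → suc j * [ suc k * suc j ≤? n ]· multiplicitySum (n ∸ suc k * suc j) (suc k) (b ∸ suc j))
    ∎
  where
  all-equal : ℕ → ℕ
  all-equal j = [ n ≟ suc k * suc j ]· suc j

  guarded-IH : ∀ i → [ suc i ≤? n ]· sptBounded (n ∸ suc i) k (suc i) ≡ ∑ (suc i) (summand n k i)
  guarded-IH i = begin
    [ suc i ≤? n ]· sptBounded (n ∸ suc i) k (suc i)
      ≡⟨ cong ([ suc i ≤? n ]·_) (sptBounded-formula k (n ∸ suc i) (suc i)) ⟩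
    [ suc i ≤? n ]· ∑ (suc i) (λ j → suc j * [ k * suc j ≤? n ∸ suc i ]· rest j)
      ≡⟨ []·-∑ (suc i ≤? n) (suc i) (λ j → suc j * [ k * suc j ≤? n ∸ suc i ]· rest j) ⟩
    ∑ (suc i) (λ j → [ suc i ≤? n ]· (suc j * [ k * suc j ≤? n ∸ suc i ]· rest j))
      ≡⟨ ∑-cong (suc i) (λ j _ → trans ([]·-* (suc i ≤? n) (suc j) _) (cong (suc j *_) (merge-guards j))) ⟩
    ∑ (suc i) (summand n k i)
      ∎
    where
    rest : ℕ → ℕ
    rest j = multiplicitySum (n ∸ suc i ∸ k * suc j) k (suc i ∸ suc j)
    merge-guards : ∀ j → [ suc i ≤? n ]· [ k * suc j ≤? n ∸ suc i ]· rest j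
                           ≡ [ suc i + k * suc j ≤? n ]· multiplicitySum (n ∸ (suc i + k * suc j)) k (suc i ∸ suc j)
    merge-guards j =
      trans (cong (λ t → [ suc i ≤? n ]· [ k * suc j ≤? n ∸ suc i ]· multiplicitySum t k (suc i ∸ suc j))
                  (∸-+-assoc n (suc i) (k * suc j)))
            ([≤]·[≤∸] (suc i) (k * suc j) n _)

multiplicitySum-large-bound : ∀ N k {c} → N ≤ c → multiplicitySum N k c ≡ multiplicitySum N k N
multiplicitySum-large-bound N k N≤c = ∑-cong k (λ ν _ → cong ((k ∸ ν) *_) (pBounded-large-bound N ν N≤c))

∑-p0 : ∀ k → ∑ k (λ ν → (k ∸ ν) * p 0 (suc ν)) ≡ k
∑-p0 zero    = refl
∑-p0 (suc k) = trans (cong (suc k * 1 +_) (∑-zero k (λ ν _ → *-zeroʳ (k ∸ ν))))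
                     (trans (+-identityʳ _) (*-identityʳ (suc k)))

multiplicitySum-diagonal : ∀ N k →
  multiplicitySum N (suc k) N ≡ Σ[1to k ] (λ ν → (suc k ∸ ν) * p N ν) + [ N ≟ 0 ]· 1
multiplicitySum-diagonal N k = trans (diagonal N) (cong (_+ [ N ≟ 0 ]· 1) (sym (sum-map-applyUpTo _ suc k)))
  where
  diagonal : ∀ N → multiplicitySum N (suc k) N ≡ ∑ k (λ ν → (k ∸ ν) * p N (suc ν)) + [ N ≟ 0 ]· 1
  diagonal zero = begin
    suc k * 1 + ∑ k (λ ν → (k ∸ ν) * 0)       ≡⟨ cong (suc k * 1 +_) (∑-zero k (λ ν _ → *-zeroʳ (k ∸ ν))) ⟩
    suc k * 1 + 0                            ≡⟨ trans (+-identityʳ _) (*-identityʳ (suc k)) ⟩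
    suc k                                    ≡⟨ +-comm 1 k ⟩
    k + 1                                    ≡⟨ cong (_+ 1) (∑-p0 k) ⟨
    ∑ k (λ ν → (k ∸ ν) * p 0 (suc ν)) + 1    ∎
  diagonal (suc N) = trans (cong (_+ tail) (*-zeroʳ (suc k))) (sym (+-identityʳ tail))
    where
    tail = ∑ k (λ ν → (k ∸ ν) * p (suc N) (suc ν))

m≤n⇒[n∸m≟0]≡m/n : ∀ {m n} .{{_ : NonZero n}} → m ≤ n → [ n ∸ m ≟ 0 ]· 1 ≡ m / n
m≤n⇒[n∸m≟0]≡m/n {m} {n} m≤n with n ∸ m ≟ 0
... | yes n∸m≡0 = sym (trans (/-congˡ (≤-antisym m≤n (m∸n≡0⇒m≤n n∸m≡0))) (n/n≡1 n))
... | no n∸m≢0  = sym (m<n⇒m/n≡0 (≤∧≢⇒< m≤n m≢n))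
  where
  m≢n : m ≢ n
  m≢n m≡n = n∸m≢0 (trans (cong (n ∸_) m≡n) (n∸n≡0 n))

m*[n/m]≤n : ∀ m n .{{_ : NonZero m}} → m * (n / m) ≤ n
m*[n/m]≤n m n = ≤-trans (≤-reflexive (*-comm m (n / m))) (m/n*n≤m n m)

spt11≡∑-multiplicitySum : ∀ n k .{{_ : NonZero k}} →
  spt11 n k ≡ ∑ (n / k) (λ j → suc j * multiplicitySum (n ∸ k * suc j) k (n ∸ k * suc j))
spt11≡∑-multiplicitySum n k = begin
  sptBounded n k n
    ≡⟨ sptBounded-formula k n n ⟩
  ∑ n term
    ≡⟨ ∑-trim term (m/n≤m n k) vanishes ⟩
  ∑ q term
    ≡⟨ ∑-cong q (λ j j<q → cong (suc j *_) (trans ([]·-yes _ (fits j<q) _) (unbounded j))) ⟩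
  ∑ q (λ j → suc j * multiplicitySum (n ∸ k * suc j) k (n ∸ k * suc j))
    ∎
  where
  q = n / k
  term : ℕ → ℕ
  term j = suc j * [ k * suc j ≤? n ]· multiplicitySum (n ∸ k * suc j) k (n ∸ suc j)
  unbounded : ∀ j → multiplicitySum (n ∸ k * suc j) k (n ∸ suc j) ≡ multiplicitySum (n ∸ k * suc j) k (n ∸ k * suc j)
  unbounded j = multiplicitySum-large-bound _ k (∸-monoʳ-≤ n (m≤n*m (suc j) k))
  fits : ∀ {j} → j < q → k * suc j ≤ n
  fits j<q = ≤-trans (*-monoʳ-≤ k j<q) (m*[n/m]≤n k n)
  too-large : ∀ {j} → q ≤ j → ¬ (k * suc j ≤ n)
  too-large {j} q≤j ksj≤n = <⇒≱ (≤-trans (≤-reflexive (sym (m*n/n≡m (suc j) k)))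
                                         (/-monoˡ-≤ k (≤-trans (≤-reflexive (*-comm (suc j) k)) ksj≤n))) q≤j
  vanishes : ∀ j → q ≤ j → term j ≡ 0
  vanishes j q≤j = trans (cong (suc j *_) ([]·-no (k * suc j ≤? n) (too-large q≤j) _)) (*-zeroʳ (suc j))

∑-[n∸km≟0] : ∀ n k q .{{_ : NonZero n}} .{{_ : NonZero k}} → k * q ≤ n →
  ∑ q (λ j → suc j * [ n ∸ k * suc j ≟ 0 ]· 1) ≡ q * (k * q / n)
∑-[n∸km≟0] n k zero    _    = refl
∑-[n∸km≟0] n k (suc r) kq≤n = begin
  ∑ (suc r) (λ j → suc j * [ n ∸ k * suc j ≟ 0 ]· 1)
    ≡⟨ ∑-last r vanishes ⟩
  suc r * [ n ∸ k * suc r ≟ 0 ]· 1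
    ≡⟨ cong (suc r *_) (m≤n⇒[n∸m≟0]≡m/n kq≤n) ⟩
  suc r * (k * suc r / n)
    ∎
  where
  below : ∀ {j} → j < r → n ∸ k * suc j ≢ 0
  below j<r n∸ksj≡0 = <⇒≱ (*-monoʳ-< k (s<s j<r)) (≤-trans kq≤n (m∸n≡0⇒m≤n n∸ksj≡0))
  vanishes : ∀ j → j < r → suc j * [ n ∸ k * suc j ≟ 0 ]· 1 ≡ 0
  vanishes j j<r = trans (cong (suc j *_) ([]·-no (n ∸ k * suc j ≟ 0) (below j<r) 1)) (*-zeroʳ (suc j))

lemma9 : (n k : ℕ) → .{{_ : NonZero n}} → .{{_ : NonZero k}} →
    spt11 n k
      ≡ (n / k) * ((k * (n / k)) / n)
        + Σ[1to (n / k) ] (λ m → m * Σ[1to (k ∸ 1) ] (λ ν → (k ∸ ν) * p (n ∸ k * m) ν))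
lemma9 n k@(suc k-1) = begin
  spt11 n k
    ≡⟨ spt11≡∑-multiplicitySum n k ⟩
  ∑ q (λ j → suc j * multiplicitySum (n ∸ k * suc j) k (n ∸ k * suc j))
    ≡⟨ ∑-cong q (λ j _ → trans (cong (suc j *_) (multiplicitySum-diagonal (n ∸ k * suc j) k-1))
                               (*-distribˡ-+ (suc j) (inner (suc j)) _)) ⟩
  ∑ q (λ j → main j + correction j)
    ≡⟨ trans (∑-distrib-+ q main correction) (+-comm (∑ q main) (∑ q correction)) ⟩
  ∑ q correction + ∑ q main
    ≡⟨ cong₂ _+_ (∑-[n∸km≟0] n k q (m*[n/m]≤n k n)) (sym (sum-map-applyUpTo (λ m → m * inner m) suc q)) ⟩
  q * (k * q / n) + Σ[1to q ] (λ m → m * inner m)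
    ∎
  where
  q = n / k
  inner : ℕ → ℕ
  inner m = Σ[1to (k ∸ 1) ] (λ ν → (k ∸ ν) * p (n ∸ k * m) ν)
  main correction : ℕ → ℕ
  main j = suc j * inner (suc j)
  correction j = suc j * [ n ∸ k * suc j ≟ 0 ]· 1
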